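{- Let $k$ be odd and $m\ge2$ an integer. Then there exists a latin square of order $n=2km$ that has a $k$-plex but has no $k'$-plex for any odd $k'<k$.
   Context: A latin square of order $n$ is viewed as a set of entries (row, column, symbol). A $k$-plex is a set of $kn$ entries containing exactly $k$ entries from each row and each column, with each symbol occurring in exactly $k$ of them. -}

module Defs where

open import Data.Nat using (ℕ; zero; suc; _+_; _*_)
open import Data.Bool using (Bool; true; false; _∧_; if_then_else_)
open import Data.Fin using (Fin; zero; suc)
open import Data.Fin.Properties using (_≟_)
open import Data.Product using (Σ; _×_)
open import Function.Definitions using (Injective)
open import Relation.Binary.PropositionalEquality using (_≡_)
open import Relation.Nullary.Decidable using (⌊_⌋)

count : (n : ℕ) → (Fin n → Bool) → ℕ
count zero    b = 0
count (suc n) b = (if b zero then 1 else 0) + count n (λ i → b (suc i))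

sumFin : (n : ℕ) → (Fin n → ℕ) → ℕ
sumFin zero    f = 0
sumFin (suc n) f = f zero + sumFin n (λ i → f (suc i))

-- A latin square of order n: L r c is the symbol in cell (r,c);
-- every symbol occurs exactly once in each row and in each column
-- (equivalently, as Fin n is finite, each row and column map is injective).
record LatinSquare (n : ℕ) : Set where
  field
    entry   : Fin n → Fin n → Fin n
    rowInj  : ∀ r → Injective _≡_ _≡_ (entry r)
    colInj  : ∀ c → Injective _≡_ _≡_ (λ r → entry r c)
open LatinSquare public

-- A set of entries of L, given by the set of cells it occupies
-- (each cell (r,c) determines the entry (r,c,L r c)).
EntrySet : ℕ → Set
EntrySet n = Fin n → Fin n → Bool

-- P is a k-plex of L: exactly k entries in each row, in each column,
-- and each symbol occurs in exactly k of the entries.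
-- (Its size is then automatically k·n.)
IsPlex : {n : ℕ} → (k : ℕ) → LatinSquare n → EntrySet n → Set
IsPlex {n} k L P =
  (∀ r → count n (λ c → P r c) ≡ k) ×
  (∀ c → count n (λ r → P r c) ≡ k) ×
  (∀ s → sumFin n (λ r → count n (λ c → P r c ∧ ⌊ entry L r c ≟ s ⌋)) ≡ k)

HasPlex : {n : ℕ} → ℕ → LatinSquare n → Set
HasPlex {n} k L = Σ (EntrySet n) (IsPlex k L)

Odd : ℕ → Set
Odd k = Σ ℕ λ j → k ≡ suc (2 * j)

module Submission where

-- The square (SwappedSquare) is the cyclic square r + c (mod n) with the symbols 0 and m
-- exchanged in every row r ≡ 0 (mod m).  It is latin because a cell of the cyclic square
-- holding 0 or m lies in a row ≡ 0 (mod m) iff it lies in a column ≡ 0 (mod m).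
-- No odd plex (NoOddPlex): summing the cell identity  r + c + m·[raised] = E r c + n·wrap
-- + m·[lowered]  over the entries of a c-plex, where the row, column and symbol sums all
-- equal c·n(n-1)/2 (PlexSums), forces p - q ≡ k (mod 2k) for the numbers p, q ≤ c of
-- raised and lowered entries, which is impossible for odd c < k.
-- The k-plex (Labels, Offsets, KPlex) consists of the cells with r ≡ λ(E r c) (mod 2m) for
-- an explicit labelling λ of the symbols.  Rows and symbols are counted directly; a column
-- is rotated into a count of "offsets", which is k except at 0 and m, where the exchange
-- in the columns ≡ 0 (mod m) repairs it.

open import Defs
open import Data.Nat using (ℕ; _*_; _<_; _≥_)
open import Data.Product using (Σ; _×_)
open import Relation.Nullary using (¬_)

open import Data.Nat hiding (_≟_)
open import Data.Nat using () renaming (_≟_ to _≟ℕ_)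
open import Data.Nat.Properties hiding (_≟_)
open import Data.Nat.DivMod
open import Data.Nat.Divisibility using (_∣_; divides)
open import Data.Bool using (Bool; true; false; if_then_else_; not; _∧_; _xor_; T)
open import Data.Bool.Properties using (∧-zeroʳ)
open import Data.Unit using (tt)
open import Data.Fin using (Fin; zero; suc; toℕ; fromℕ<)
open import Data.Fin.Properties using (toℕ-injective; toℕ-fromℕ<; toℕ<n; _≟_)
open import Relation.Binary.PropositionalEquality
open import Relation.Nullary using (yes; no)
open import Relation.Nullary.Decidable using (⌊_⌋)
open import Data.Empty using (⊥; ⊥-elim)
open import Data.Sum using (_⊎_; inj₁; inj₂)
open import Data.Product using (_,_; proj₁; proj₂)
open import Data.Nat.Tactic.RingSolver

ind : Bool → ℕ
ind b = if b then 1 else 0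

cnt : ℕ → (ℕ → Bool) → ℕ
cnt zero    f = 0
cnt (suc n) f = ind (f 0) + cnt n (λ i → f (suc i))

sumℕ : ℕ → (ℕ → ℕ) → ℕ
sumℕ zero    f = 0
sumℕ (suc n) f = f 0 + sumℕ n (λ i → f (suc i))

cnt-ext : ∀ n {f g : ℕ → Bool} → (∀ i → i < n → f i ≡ g i) → cnt n f ≡ cnt n g
cnt-ext zero    h = refl
cnt-ext (suc n) h = cong₂ _+_ (cong ind (h 0 z<s)) (cnt-ext n (λ i p → h (suc i) (s<s p)))

sumℕ-ext : ∀ n {f g : ℕ → ℕ} → (∀ i → i < n → f i ≡ g i) → sumℕ n f ≡ sumℕ n g
sumℕ-ext zero    h = refl
sumℕ-ext (suc n) h = cong₂ _+_ (h 0 z<s) (sumℕ-ext n (λ i p → h (suc i) (s<s p)))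

cnt-sum : ∀ n f → cnt n f ≡ sumℕ n (λ i → ind (f i))
cnt-sum zero    f = refl
cnt-sum (suc n) f = cong (ind (f 0) +_) (cnt-sum n (λ i → f (suc i)))

sumℕ-+ : ∀ n f g → sumℕ n (λ i → f i + g i) ≡ sumℕ n f + sumℕ n g
sumℕ-+ zero    f g = refl
sumℕ-+ (suc n) f g rewrite sumℕ-+ n (λ i → f (suc i)) (λ i → g (suc i)) =
  +-+-comm (f 0) (g 0) _ _
  where
  +-+-comm : ∀ a b c d → a + b + (c + d) ≡ a + c + (b + d)
  +-+-comm = solve-∀

sumℕ-const : ∀ q c → sumℕ q (λ _ → c) ≡ q * c
sumℕ-const zero    c = refl
sumℕ-const (suc q) c = cong (c +_) (sumℕ-const q c)

cnt-false : ∀ n f → (∀ i → i < n → f i ≡ false) → cnt n f ≡ 0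
cnt-false zero    f h = refl
cnt-false (suc n) f h rewrite h 0 z<s = cnt-false n (λ i → f (suc i)) (λ i p → h (suc i) (s<s p))

cnt-∧ˡ : ∀ n b f → cnt n (λ i → b ∧ f i) ≡ ind b * cnt n f
cnt-∧ˡ n false f = cnt-false n _ (λ _ _ → refl)
cnt-∧ˡ n true  f = sym (+-identityʳ (cnt n f))

cnt-split : ∀ a b f → cnt (a + b) f ≡ cnt a f + cnt b (λ i → f (a + i))
cnt-split zero    b f = refl
cnt-split (suc a) b f =
  trans (cong (ind (f 0) +_) (cnt-split a b (λ i → f (suc i)))) (sym (+-assoc (ind (f 0)) _ _))

cnt-block : ∀ q M f → cnt (q * M) f ≡ sumℕ q (λ t → cnt M (λ i → f (t * M + i)))
cnt-block zero    M f = refl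
cnt-block (suc q) M f = trans (cnt-split M (q * M) f)
  (cong (cnt M f +_) (trans (cnt-block q M (λ i → f (M + i)))
     (sumℕ-ext q (λ t _ → cnt-ext M (λ i _ → cong f (sym (+-assoc M (t * M) i)))))))

par : ℕ → Bool
par zero          = false
par (suc zero)    = true
par (suc (suc n)) = par n

sumℕ-parity : ∀ j f a b → (∀ q → f q ≡ (if par q then b else a)) →
  sumℕ (suc (2 * j)) f ≡ suc j * a + j * b
sumℕ-parity zero    f a b h = trans (cong (_+ 0) (h 0)) (ar a b)
  where ar : ∀ a b → a + 0 ≡ 1 * a + 0 * b
        ar = solve-∀
sumℕ-parity (suc j) f a b h = begin
    sumℕ (suc (2 * suc j)) f
  ≡⟨ cong (λ z → sumℕ z f) (two-more j) ⟩
    f 0 + (f 1 + sumℕ (suc (2 * j)) (λ i → f (2 + i)))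
  ≡⟨ cong₂ (λ x y → x + (y + sumℕ (suc (2 * j)) (λ i → f (2 + i)))) (h 0) (h 1) ⟩
    a + (b + sumℕ (suc (2 * j)) (λ i → f (2 + i)))
  ≡⟨ cong (λ z → a + (b + z)) (sumℕ-parity j (λ i → f (2 + i)) a b (λ q → h (2 + q))) ⟩
    a + (b + (suc j * a + j * b))
  ≡⟨ ar j a b ⟩
    suc (suc j) * a + suc j * b ∎
  where
  open ≡-Reasoning
  two-more : ∀ j → suc (2 * suc j) ≡ 2 + suc (2 * j)
  two-more = solve-∀
  ar : ∀ j a b → a + (b + (suc j * a + j * b)) ≡ suc (suc j) * a + suc j * b
  ar = solve-∀

beq-true : ∀ a b → (a ≡ᵇ b) ≡ true → a ≡ b
beq-true a b e = ≡ᵇ⇒≡ a b (subst T (sym e) tt)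

beq-refl : ∀ a → (a ≡ᵇ a) ≡ true
beq-refl zero    = refl
beq-refl (suc a) = beq-refl a

beq-eq : ∀ {a b} → a ≡ b → (a ≡ᵇ b) ≡ true
beq-eq {a} refl = beq-refl a

beq-false : ∀ a b → ¬ a ≡ b → (a ≡ᵇ b) ≡ false
beq-false zero    zero    ne = ⊥-elim (ne refl)
beq-false zero    (suc b) ne = refl
beq-false (suc a) zero    ne = refl
beq-false (suc a) (suc b) ne = beq-false a b (λ e → ne (cong suc e))

beq-iff : ∀ {a b c d} → (a ≡ b → c ≡ d) → (c ≡ d → a ≡ b) → (a ≡ᵇ b) ≡ (c ≡ᵇ d)
beq-iff {a} {b} {c} {d} to from with a ≟ℕ b
... | yes e = trans (beq-eq e) (sym (beq-eq (to e)))
... | no ne = trans (beq-false a b ne) (sym (beq-false c d (λ e → ne (from e))))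

cnt-one : ∀ n a → a < n → cnt n (λ i → i ≡ᵇ a) ≡ 1
cnt-one (suc n) zero    p       = cong suc (cnt-false n _ (λ i _ → refl))
cnt-one (suc n) (suc a) (s≤s p) = cnt-one n a p

window-in : ∀ L d a → d ≤ a → a < d + L → cnt L (λ i → a ≡ᵇ (i + d)) ≡ 1
window-in L d a d≤a a<d+L =
  trans (cnt-ext L (λ i _ → beq-iff to from)) (cnt-one L (a ∸ d) a∸d<L)
  where
  to : ∀ {i} → a ≡ i + d → i ≡ a ∸ d
  to {i} e = sym ( trans (cong (_∸ d) e) (m+n∸n≡m i d))
  from : ∀ {i} → i ≡ a ∸ d → a ≡ i + d
  from e = trans (sym (m∸n+n≡m d≤a)) (cong (_+ d) (sym e))
  a∸d<L : a ∸ d < L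
  a∸d<L = +-cancelˡ-< d (a ∸ d) L (subst (_< d + L) (sym (m+[n∸m]≡n d≤a)) a<d+L)

window-out : ∀ L d a → (a < d ⊎ d + L ≤ a) → cnt L (λ i → a ≡ᵇ (i + d)) ≡ 0
window-out L d a out = cnt-false L _ (λ i i<L → beq-false a (i + d) (miss i i<L out))
  where
  miss : ∀ i → i < L → (a < d ⊎ d + L ≤ a) → ¬ a ≡ i + d
  miss i _   (inj₁ a<d)   e = <⇒≱ a<d (subst (d ≤_) (sym e) (m≤n+m d i))
  miss i i<L (inj₂ d+L≤a) e =
    <⇒≱ (subst (_< d + L) (trans (+-comm d i) (sym e)) (+-monoʳ-< d i<L)) d+L≤a

cnt-update : ∀ n a f g → a < n → (∀ i → i < n → ¬ i ≡ a → f i ≡ g i) →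
  cnt n f + ind (g a) ≡ cnt n g + ind (f a)
cnt-update (suc n) zero f g _ h = begin
    ind (f 0) + cnt n (λ i → f (suc i)) + ind (g 0)
  ≡⟨ cong (λ z → ind (f 0) + z + ind (g 0)) (cnt-ext n (λ i p → h (suc i) (s<s p) (λ ()))) ⟩
    ind (f 0) + cnt n (λ i → g (suc i)) + ind (g 0)
  ≡⟨ exchange (ind (f 0)) _ (ind (g 0)) ⟩
    ind (g 0) + cnt n (λ i → g (suc i)) + ind (f 0) ∎
  where
  open ≡-Reasoning
  exchange : ∀ x y z → x + y + z ≡ z + y + x
  exchange = solve-∀
cnt-update (suc n) (suc a) f g (s≤s a<n) h = begin
    ind (f 0) + cnt n (λ i → f (suc i)) + ind (g (suc a))
  ≡⟨ +-assoc (ind (f 0)) _ _ ⟩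
    ind (f 0) + (cnt n (λ i → f (suc i)) + ind (g (suc a)))
  ≡⟨ cong₂ _+_ (cong ind (h 0 z<s (λ ())))
       (cnt-update n a (λ i → f (suc i)) (λ i → g (suc i)) a<n
          (λ i p i≢a → h (suc i) (s<s p) (λ e → i≢a (suc-injective e)))) ⟩
    ind (g 0) + (cnt n (λ i → g (suc i)) + ind (f (suc a)))
  ≡⟨ sym (+-assoc (ind (g 0)) _ _) ⟩
    ind (g 0) + cnt n (λ i → g (suc i)) + ind (f (suc a)) ∎
  where open ≡-Reasoning

-- The same for two distinct points a, b < n: apply cnt-update to f → h → g,
-- where h agrees with g at a and with f elsewhere.
cnt-update₂ : ∀ n a b f g → a < n → b < n → ¬ b ≡ a →
  (∀ i → i < n → ¬ i ≡ a → ¬ i ≡ b → f i ≡ g i) →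
  cnt n f + ind (g a) + ind (g b) ≡ cnt n g + ind (f a) + ind (f b)
cnt-update₂ n a b f g a<n b<n b≢a agree = begin
    cnt n f + ind (g a) + ind (g b)
  ≡⟨ cong (λ z → cnt n f + ind z + ind (g b)) (sym h-at-a) ⟩
    cnt n f + ind (h a) + ind (g b)
  ≡⟨ cong (_+ ind (g b)) (cnt-update n a f h a<n f≈h) ⟩
    cnt n h + ind (f a) + ind (g b)
  ≡⟨ exchange (cnt n h) (ind (f a)) (ind (g b)) ⟩
    cnt n h + ind (g b) + ind (f a)
  ≡⟨ cong (_+ ind (f a)) (cnt-update n b h g b<n h≈g) ⟩
    cnt n g + ind (h b) + ind (f a)
  ≡⟨ cong (λ z → cnt n g + ind z + ind (f a)) h-at-b ⟩
    cnt n g + ind (f b) + ind (f a)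
  ≡⟨ exchange (cnt n g) (ind (f b)) (ind (f a)) ⟩
    cnt n g + ind (f a) + ind (f b) ∎
  where
  open ≡-Reasoning
  h : ℕ → Bool
  h i = if i ≡ᵇ a then g i else f i
  h-at-a : h a ≡ g a
  h-at-a rewrite beq-refl a = refl
  h-at-b : h b ≡ f b
  h-at-b rewrite beq-false b a b≢a = refl
  f≈h : ∀ i → i < n → ¬ i ≡ a → f i ≡ h i
  f≈h i _ i≢a rewrite beq-false i a i≢a = refl
  h≈g : ∀ i → i < n → ¬ i ≡ b → h i ≡ g i
  h≈g i i<n i≢b with i ≟ℕ a
  ... | yes refl = h-at-a
  ... | no i≢a rewrite beq-false i a i≢a = agree i i<n i≢a i≢b
  exchange : ∀ x y z → x + y + z ≡ x + z + y
  exchange = solve-∀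

addMod : ℕ → ℕ → ℕ → ℕ
addMod n r c = if (r + c) <ᵇ n then r + c else (r + c) ∸ n

wrap : ℕ → ℕ → ℕ → ℕ
wrap n r c = if (r + c) <ᵇ n then 0 else 1

addMod-below : ∀ n r c → r + c < n → addMod n r c ≡ r + c
addMod-below n r c p with (r + c) <ᵇ n | <⇒<ᵇ p
... | true | _ = refl

addMod-above : ∀ n r c → n ≤ r + c → addMod n r c ≡ r + c ∸ n
addMod-above n r c p with (r + c) <ᵇ n in eq
... | false = refl
... | true  = ⊥-elim (<⇒≱ (<ᵇ⇒< (r + c) n (subst T (sym eq) tt)) p)

addMod-comm : ∀ n r c → addMod n r c ≡ addMod n c r
addMod-comm n r c rewrite +-comm r c = refl

addMod-< : ∀ n r c → r < n → c < n → addMod n r c < n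
addMod-< n r c p q with r + c <? n
... | yes h = subst (_< n) (sym (addMod-below n r c h)) h
... | no h  = subst (_< n) (sym (addMod-above n r c (≮⇒≥ h)))
   (+-cancelʳ-< n (r + c ∸ n) n (subst (_< n + n) (sym (m∸n+n≡m (≮⇒≥ h))) (+-mono-< p q)))

-- r + c = addMod n r c + n · wrap n r c: the identity behind all congruences mod divisors of n.
addMod-decomp : ∀ n r c → r + c ≡ addMod n r c + n * wrap n r c
addMod-decomp n r c with r + c <ᵇ n in eq
... | true  = sym (trans (cong (r + c +_) (*-zeroʳ n)) (+-identityʳ (r + c)))
... | false = sym (trans (cong (r + c ∸ n +_) (*-identityʳ n))
                    (m∸n+n≡m {r + c} {n} (≮⇒≥ (λ lt → subst T eq (<⇒<ᵇ lt)))))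

-- r + x = r + y - n with n ≤ r + y forces y = x + n, so y is out of range.
addMod-no-mixed : ∀ n r x y → r + x ≡ r + y ∸ n → n ≤ r + y → n ≤ y
addMod-no-mixed n r x y e q = subst (n ≤_) (sym (+-cancelˡ-≡ r y (x + n)
  (trans (sym (m∸n+n≡m q)) (trans (cong (_+ n) (sym e)) (+-assoc r x n))))) (m≤n+m n x)

addMod-injective : ∀ n r {c c'} → c < n → c' < n → addMod n r c ≡ addMod n r c' → c ≡ c'
addMod-injective n r {c} {c'} p p' e with r + c <? n | r + c' <? n
... | yes h | yes h' = +-cancelˡ-≡ r c c'
        (trans (sym (addMod-below n r c h)) (trans e (addMod-below n r c' h')))
... | no h  | no h'  = +-cancelˡ-≡ r c c' (∸-cancelʳ-≡ (≮⇒≥ h) (≮⇒≥ h')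
        (trans (sym (addMod-above n r c (≮⇒≥ h))) (trans e (addMod-above n r c' (≮⇒≥ h')))))
... | yes h | no h'  = ⊥-elim (<⇒≱ p' (addMod-no-mixed n r c c'
        (trans (sym (addMod-below n r c h)) (trans e (addMod-above n r c' (≮⇒≥ h')))) (≮⇒≥ h')))
... | no h  | yes h' = ⊥-elim (<⇒≱ p (addMod-no-mixed n r c' c
        (trans (sym (addMod-below n r c' h')) (trans (sym e) (addMod-above n r c (≮⇒≥ h)))) (≮⇒≥ h)))

-- Translation by r ≤ n permutes [0, n), so it preserves counts.
cnt-rotate : ∀ n r f → r ≤ n → cnt n (λ c → f (addMod n r c)) ≡ cnt n f
cnt-rotate n r f r≤n = begin
    cnt n (λ c → f (addMod n r c))
  ≡⟨ cong (λ x → cnt x (λ c → f (addMod n r c))) (sym (m∸n+n≡m r≤n)) ⟩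
    cnt ((n ∸ r) + r) (λ c → f (addMod n r c))
  ≡⟨ cnt-split (n ∸ r) r _ ⟩
    cnt (n ∸ r) (λ c → f (addMod n r c)) + cnt r (λ i → f (addMod n r (n ∸ r + i)))
  ≡⟨ cong₂ _+_ (cnt-ext (n ∸ r) (λ c p → cong f (addMod-below n r c (no-wrap c p))))
               (cnt-ext r (λ i p → cong f (trans (addMod-above n r (n ∸ r + i) (wraps i)) (wrapped i)))) ⟩
    cnt (n ∸ r) (λ c → f (r + c)) + cnt r f
  ≡⟨ +-comm _ (cnt r f) ⟩
    cnt r f + cnt (n ∸ r) (λ c → f (r + c))
  ≡⟨ sym (cnt-split r (n ∸ r) f) ⟩
    cnt (r + (n ∸ r)) f
  ≡⟨ cong (λ x → cnt x f) (m+[n∸m]≡n r≤n) ⟩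
    cnt n f ∎
  where
  open ≡-Reasoning
  shift : ∀ i → r + (n ∸ r + i) ≡ n + i
  shift i = trans (sym (+-assoc r (n ∸ r) i)) (cong (_+ i) (m+[n∸m]≡n r≤n))
  no-wrap : ∀ c → c < n ∸ r → r + c < n
  no-wrap c p = subst (r + c <_) (m+[n∸m]≡n r≤n) (+-monoʳ-< r p)
  wraps : ∀ i → n ≤ r + (n ∸ r + i)
  wraps i = subst (n ≤_) (sym (shift i)) (m≤m+n n i)
  wrapped : ∀ i → r + (n ∸ r + i) ∸ n ≡ i
  wrapped i = trans (cong (_∸ n) (shift i)) (m+n∸m≡n n i)

module _ (M : ℕ) .{{_ : NonZero M}} where

  block-mod : ∀ q σ → σ < M → (q * M + σ) % M ≡ σ
  block-mod q σ p = trans (cong (_% M) (+-comm (q * M) σ)) (trans ([m+kn]%n≡m%n σ q M) (m<n⇒m%n≡m p))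

  block-div : ∀ q σ → σ < M → (q * M + σ) / M ≡ q
  block-div q σ p = trans (cong (_/ M) (+-comm (q * M) σ))
    (trans (+-distrib-/-∣ʳ σ (divides q refl)) (cong₂ _+_ (m<n⇒m/n≡0 p) (m*n/n≡m q M)))

  plusM-mod : ∀ x → x < M → (x + M) % M ≡ x
  plusM-mod x p = trans ([m+n]%n≡m%n x M) (m<n⇒m%n≡m p)

  %-absorbˡ : ∀ x z → (x % M + z) % M ≡ (x + z) % M
  %-absorbˡ x z = trans (%-distribˡ-+ (x % M) z M)
    (trans (cong (λ u → (u + z % M) % M) (m%n%n≡m%n x M)) (sym (%-distribˡ-+ x z M)))

  -- Congruences can be cancelled: adding z and then M - (z mod M) adds a multiple of M.
  %-cancelʳ : ∀ x y z → (x + z) % M ≡ (y + z) % M → x % M ≡ y % M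
  %-cancelʳ x y z e = trans (sym (undo x)) (trans e′ (undo y))
    where
    w = M ∸ z % M
    z+w : z + w ≡ suc (z / M) * M
    z+w = begin
        z + w
      ≡⟨ cong (_+ w) (m≡m%n+[m/n]*n z M) ⟩
        z % M + z / M * M + w
      ≡⟨ ar (z % M) (z / M * M) w ⟩
        z / M * M + (z % M + w)
      ≡⟨ cong (z / M * M +_) (m+[n∸m]≡n (<⇒≤ (m%n<n z M))) ⟩
        z / M * M + M
      ≡⟨ +-comm (z / M * M) M ⟩
        suc (z / M) * M ∎
      where open ≡-Reasoning
            ar : ∀ a b c → a + b + c ≡ b + (a + c)
            ar = solve-∀
    undo : ∀ x → (x + z + w) % M ≡ x % M
    undo x = trans (cong (_% M) (trans (+-assoc x z w) (cong (x +_) z+w))) ([m+kn]%n≡m%n x (suc (z / M)) M)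
    e′ : (x + z + w) % M ≡ (y + z + w) % M
    e′ = trans (sym (%-absorbˡ (x + z) w)) (trans (cong (λ u → (u + w) % M) e) (%-absorbˡ (y + z) w))

  residue-test : ∀ a b y → a < M → b < M → y < M →
    (a ≡ᵇ y) ≡ (b ≡ᵇ (((a + b) % M + (M ∸ y)) % M))
  residue-test a b y a<M b<M y<M = beq-iff to from
    where
    subtract : ∀ x → x ≤ M → (x + b + (M ∸ x)) % M ≡ b
    subtract x x≤M = trans (cong (_% M) (trans (cong (_+ (M ∸ x)) (+-comm x b))
      (trans (+-assoc b x (M ∸ x)) (cong (b +_) (m+[n∸m]≡n x≤M))))) (plusM-mod b b<M)
    to : a ≡ y → b ≡ ((a + b) % M + (M ∸ y)) % M
    to refl = sym (trans (%-absorbˡ (a + b) (M ∸ a)) (subtract a (<⇒≤ a<M)))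
    from : b ≡ ((a + b) % M + (M ∸ y)) % M → a ≡ y
    from e = trans (sym (m<n⇒m%n≡m a<M)) (trans (%-cancelʳ a y (b + (M ∸ y)) same) (m<n⇒m%n≡m y<M))
      where
      same : (a + (b + (M ∸ y))) % M ≡ (y + (b + (M ∸ y))) % M
      same = begin
          (a + (b + (M ∸ y))) % M       ≡⟨ cong (_% M) (sym (+-assoc a b _)) ⟩
          (a + b + (M ∸ y)) % M         ≡⟨ sym (%-absorbˡ (a + b) (M ∸ y)) ⟩
          ((a + b) % M + (M ∸ y)) % M   ≡⟨ sym e ⟩
          b                             ≡⟨ sym (subtract y (<⇒≤ y<M)) ⟩
          (y + b + (M ∸ y)) % M         ≡⟨ cong (_% M) (+-assoc y b _) ⟩
          (y + (b + (M ∸ y))) % M       ∎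
        where open ≡-Reasoning

  %-zero-cancelˡ : ∀ x y → (x + y) % M ≡ 0 → x % M ≡ 0 → y % M ≡ 0
  %-zero-cancelˡ x y x+y≡0 x≡0 = begin
      y % M                   ≡⟨ sym (m%n%n≡m%n y M) ⟩
      (0 + y % M) % M         ≡⟨ cong (λ u → (u + y % M) % M) (sym x≡0) ⟩
      (x % M + y % M) % M     ≡⟨ sym (%-distribˡ-+ x y M) ⟩
      (x + y) % M             ≡⟨ x+y≡0 ⟩
      0                       ∎
    where open ≡-Reasoning

sumFin-ext : ∀ n {f g : Fin n → ℕ} → (∀ i → f i ≡ g i) → sumFin n f ≡ sumFin n g
sumFin-ext zero    h = refl
sumFin-ext (suc n) h = cong₂ _+_ (h zero) (sumFin-ext n (λ i → h (suc i)))

sumFin-zero : ∀ n → sumFin n (λ _ → 0) ≡ 0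
sumFin-zero zero    = refl
sumFin-zero (suc n) = sumFin-zero n

sumFin-+ : ∀ n (f g : Fin n → ℕ) → sumFin n (λ i → f i + g i) ≡ sumFin n f + sumFin n g
sumFin-+ zero    f g = refl
sumFin-+ (suc n) f g rewrite sumFin-+ n (λ i → f (suc i)) (λ i → g (suc i)) = ar (f zero) (g zero) _ _
  where ar : ∀ a b c d → a + b + (c + d) ≡ a + c + (b + d)
        ar = solve-∀

sumFin-* : ∀ n a (f : Fin n → ℕ) → sumFin n (λ i → a * f i) ≡ a * sumFin n f
sumFin-* zero    a f = sym (*-zeroʳ a)
sumFin-* (suc n) a f rewrite sumFin-* n a (λ i → f (suc i)) = sym (*-distribˡ-+ a (f zero) _)

sumFin-swap : ∀ n p (f : Fin n → Fin p → ℕ) →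
  sumFin n (λ i → sumFin p (λ j → f i j)) ≡ sumFin p (λ j → sumFin n (λ i → f i j))
sumFin-swap zero    p f = sym (sumFin-zero p)
sumFin-swap (suc n) p f = trans (cong (sumFin p (f zero) +_) (sumFin-swap n p (λ i → f (suc i))))
   (sym (sumFin-+ p (f zero) (λ j → sumFin n (λ i → f (suc i) j))))

sumFin-mono : ∀ n {f g : Fin n → ℕ} → (∀ i → f i ≤ g i) → sumFin n f ≤ sumFin n g
sumFin-mono zero    h = z≤n
sumFin-mono (suc n) h = +-mono-≤ (h zero) (sumFin-mono n (λ i → h (suc i)))

count-sum : ∀ n (b : Fin n → Bool) → count n b ≡ sumFin n (λ i → ind (b i))
count-sum zero    b = refl
count-sum (suc n) b = cong (ind (b zero) +_) (count-sum n (λ i → b (suc i)))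

sumFin-delta : ∀ n (x : Fin n) (g : Fin n → ℕ) → sumFin n (λ s → ind ⌊ x ≟ s ⌋ * g s) ≡ g x
sumFin-delta (suc n) zero    g = trans (cong₂ _+_ (+-identityʳ (g zero)) (sumFin-zero n)) (+-identityʳ _)
sumFin-delta (suc n) (suc x) g =
  trans (sumFin-ext n (λ i → cong (λ b → ind b * g (suc i)) (suc-≟-suc x i))) (sumFin-delta n x (λ i → g (suc i)))
  where
  suc-≟-suc : ∀ {n} (x i : Fin n) → ⌊ Fin.suc x ≟ Fin.suc i ⌋ ≡ ⌊ x ≟ i ⌋
  suc-≟-suc x i with x ≟ i
  ... | yes _ = refl
  ... | no _  = refl

gauss : ∀ n → 2 * sumFin n toℕ + n ≡ n * n
gauss zero    = refl
gauss (suc n) = begin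
    2 * (0 + sumFin n (λ i → suc (toℕ i))) + suc n
  ≡⟨ cong (λ z → 2 * z + suc n) (sumFin-+ n (λ _ → 1) toℕ) ⟩
    2 * (sumFin n (λ _ → 1) + sumFin n toℕ) + suc n
  ≡⟨ cong (λ z → 2 * (z + sumFin n toℕ) + suc n) (ones n) ⟩
    2 * (n + sumFin n toℕ) + suc n
  ≡⟨ ar n (sumFin n toℕ) ⟩
    (2 * sumFin n toℕ + n) + 2 * n + 1
  ≡⟨ cong (λ z → z + 2 * n + 1) (gauss n) ⟩
    n * n + 2 * n + 1
  ≡⟨ square n ⟩
    suc n * suc n ∎
  where
  open ≡-Reasoning
  ones : ∀ n → sumFin n (λ _ → 1) ≡ n
  ones zero    = refl
  ones (suc n) = cong suc (ones n)
  ar : ∀ n t → 2 * (n + t) + suc n ≡ 2 * t + n + 2 * n + 1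
  ar = solve-∀
  square : ∀ n → n * n + 2 * n + 1 ≡ suc n * suc n
  square = solve-∀

ind-∧ : ∀ a b → ind a * ind b ≡ ind (a ∧ b)
ind-∧ false b     = refl
ind-∧ true  false = refl
ind-∧ true  true  = refl

ind-≤ : ∀ {a b : Bool} → (a ≡ true → b ≡ true) → ind a ≤ ind b
ind-≤ {false} h = z≤n
ind-≤ {true}  h rewrite h refl = ≤-refl

-- Every row index, every column index and every symbol occurs exactly c times
-- among the entries, so each of the three index sums equals c·(0 + 1 + … + (n-1)).
module PlexSums {n : ℕ} (L : LatinSquare n) (c : ℕ) (P : EntrySet n) (plex : IsPlex c L P) where

  ΣP : (Fin n → Fin n → ℕ) → ℕ
  ΣP g = sumFin n (λ r → sumFin n (λ col → ind (P r col) * g r col))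

  ΣP-ext : ∀ {f g} → (∀ r col → f r col ≡ g r col) → ΣP f ≡ ΣP g
  ΣP-ext h = sumFin-ext n (λ r → sumFin-ext n (λ col → cong (ind (P r col) *_) (h r col)))

  ΣP-+ : ∀ f g → ΣP (λ r col → f r col + g r col) ≡ ΣP f + ΣP g
  ΣP-+ f g = trans (sumFin-ext n (λ r → trans (sumFin-ext n (λ col → *-distribˡ-+ (ind (P r col)) (f r col) (g r col)))
                 (sumFin-+ n _ _))) (sumFin-+ n _ _)

  ΣP-* : ∀ a f → ΣP (λ r col → a * f r col) ≡ a * ΣP f
  ΣP-* a f = trans (sumFin-ext n (λ r → trans (sumFin-ext n (λ col → ar (ind (P r col)) a (f r col)))
                 (sumFin-* n a _))) (sumFin-* n a _)
    where ar : ∀ x a y → x * (a * y) ≡ a * (x * y)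
          ar = solve-∀

  ΣP-sumFin : ∀ (g : Fin n → Fin n → Fin n → ℕ) →
    ΣP (λ r col → sumFin n (g r col)) ≡ sumFin n (λ s → ΣP (λ r col → g r col s))
  ΣP-sumFin g = begin
      sumFin n (λ r → sumFin n (λ col → ind (P r col) * sumFin n (g r col)))
    ≡⟨ sumFin-ext n (λ r → sumFin-ext n (λ col → sym (sumFin-* n (ind (P r col)) (g r col)))) ⟩
      sumFin n (λ r → sumFin n (λ col → sumFin n (λ s → ind (P r col) * g r col s)))
    ≡⟨ sumFin-ext n (λ r → sumFin-swap n n _) ⟩
      sumFin n (λ r → sumFin n (λ s → sumFin n (λ col → ind (P r col) * g r col s)))
    ≡⟨ sumFin-swap n n _ ⟩
      sumFin n (λ s → ΣP (λ r col → g r col s)) ∎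
    where open ≡-Reasoning

  symbol-count : ∀ s → ΣP (λ r col → ind ⌊ entry L r col ≟ s ⌋) ≡ c
  symbol-count s = trans (sumFin-ext n (λ r → trans (sumFin-ext n (λ col → ind-∧ (P r col) _))
                     (sym (count-sum n (λ col → P r col ∧ ⌊ entry L r col ≟ s ⌋)))))
                   (proj₂ (proj₂ plex) s)

  symbol-bound : ∀ s (b : Fin n → Fin n → Bool) → (∀ r col → b r col ≡ true → entry L r col ≡ s) →
    ΣP (λ r col → ind (b r col)) ≤ c
  symbol-bound s b forces = subst (ΣP (λ r col → ind (b r col)) ≤_) (symbol-count s)
    (sumFin-mono n (λ r → sumFin-mono n (λ col → *-monoʳ-≤ (ind (P r col))
      (ind-≤ (λ h → yes-true (forces r col h))))))
    where
    yes-true : ∀ {x y : Fin n} → x ≡ y → ⌊ x ≟ y ⌋ ≡ true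
    yes-true {x} {y} e with x ≟ y
    ... | yes _ = refl
    ... | no ne = ⊥-elim (ne e)

  ΣP-rows : ΣP (λ r _ → toℕ r) ≡ c * sumFin n toℕ
  ΣP-rows = trans (sumFin-ext n per-row) (sumFin-* n c toℕ)
    where
    per-row : ∀ r → sumFin n (λ col → ind (P r col) * toℕ r) ≡ c * toℕ r
    per-row r = begin
        sumFin n (λ col → ind (P r col) * toℕ r)
      ≡⟨ sumFin-ext n (λ col → *-comm (ind (P r col)) (toℕ r)) ⟩
        sumFin n (λ col → toℕ r * ind (P r col))
      ≡⟨ sumFin-* n (toℕ r) _ ⟩
        toℕ r * sumFin n (λ col → ind (P r col))
      ≡⟨ cong (toℕ r *_) (trans (sym (count-sum n (P r))) (proj₁ plex r)) ⟩
        toℕ r * c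
      ≡⟨ *-comm (toℕ r) c ⟩
        c * toℕ r ∎
      where open ≡-Reasoning

  ΣP-cols : ΣP (λ _ col → toℕ col) ≡ c * sumFin n toℕ
  ΣP-cols = trans (sumFin-swap n n (λ r col → ind (P r col) * toℕ col))
                  (trans (sumFin-ext n per-col) (sumFin-* n c toℕ))
    where
    per-col : ∀ col → sumFin n (λ r → ind (P r col) * toℕ col) ≡ c * toℕ col
    per-col col = begin
        sumFin n (λ r → ind (P r col) * toℕ col)
      ≡⟨ sumFin-ext n (λ r → *-comm (ind (P r col)) (toℕ col)) ⟩
        sumFin n (λ r → toℕ col * ind (P r col))
      ≡⟨ sumFin-* n (toℕ col) _ ⟩
        toℕ col * sumFin n (λ r → ind (P r col))
      ≡⟨ cong (toℕ col *_) (trans (sym (count-sum n (λ r → P r col))) (proj₁ (proj₂ plex) col)) ⟩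
        toℕ col * c
      ≡⟨ *-comm (toℕ col) c ⟩
        c * toℕ col ∎
      where open ≡-Reasoning

  ΣP-symbols : ΣP (λ r col → toℕ (entry L r col)) ≡ c * sumFin n toℕ
  ΣP-symbols = begin
      ΣP (λ r col → toℕ (entry L r col))
    ≡⟨ ΣP-ext (λ r col → sym (sumFin-delta n (entry L r col) toℕ)) ⟩
      ΣP (λ r col → sumFin n (λ s → ind ⌊ entry L r col ≟ s ⌋ * toℕ s))
    ≡⟨ ΣP-sumFin (λ r col s → ind ⌊ entry L r col ≟ s ⌋ * toℕ s) ⟩
      sumFin n (λ s → ΣP (λ r col → ind ⌊ entry L r col ≟ s ⌋ * toℕ s))
    ≡⟨ sumFin-ext n (λ s → trans (ΣP-ext (λ r col → *-comm _ (toℕ s)))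
                                 (trans (ΣP-* (toℕ s) _) (cong (toℕ s *_) (symbol-count s)))) ⟩
      sumFin n (λ s → toℕ s * c)
    ≡⟨ trans (sumFin-ext n (λ s → *-comm (toℕ s) c)) (sumFin-* n c toℕ) ⟩
      c * sumFin n toℕ ∎
    where open ≡-Reasoning

count-ext : ∀ n {f g : Fin n → Bool} → (∀ i → f i ≡ g i) → count n f ≡ count n g
count-ext zero    h = refl
count-ext (suc n) h = cong₂ _+_ (cong ind (h zero)) (count-ext n (λ i → h (suc i)))

count-toℕ : ∀ n (f : ℕ → Bool) → count n (λ i → f (toℕ i)) ≡ cnt n f
count-toℕ zero    f = refl
count-toℕ (suc n) f = cong (ind (f 0) +_) (count-toℕ n (λ i → f (suc i)))

sumFin-toℕ : ∀ n g → sumFin n (λ i → g (toℕ i)) ≡ sumℕ n g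
sumFin-toℕ zero    g = refl
sumFin-toℕ (suc n) g = cong (g 0 +_) (sumFin-toℕ n (λ i → g (suc i)))

≟-as-≡ᵇ : ∀ {n} (x y : Fin n) → ⌊ x ≟ y ⌋ ≡ (toℕ x ≡ᵇ toℕ y)
≟-as-≡ᵇ x y with x ≟ y
... | yes refl = sym (beq-refl (toℕ x))
... | no ne    = sym (beq-false (toℕ x) (toℕ y) (λ e → ne (toℕ-injective e)))

transp : ℕ → ℕ → ℕ
transp m x = if x ≡ᵇ 0 then m else (if x ≡ᵇ m then 0 else x)

transp-m : ∀ m → transp m m ≡ 0
transp-m zero    = refl
transp-m (suc m) rewrite beq-refl m = refl

transp-id : ∀ m x → ¬ x ≡ 0 → ¬ x ≡ m → transp m x ≡ x
transp-id m x x≢0 x≢m rewrite beq-false x 0 x≢0 | beq-false x m x≢m = refl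

transp-involutive : ∀ m x → transp m (transp m x) ≡ x
transp-involutive m x with x ≟ℕ 0
... | yes refl = transp-m m
... | no x≢0 with x ≟ℕ m
...   | yes refl rewrite transp-m x = refl
...   | no x≢m rewrite transp-id m x x≢0 x≢m = transp-id m x x≢0 x≢m

transp-injective : ∀ m {x y} → transp m x ≡ transp m y → x ≡ y
transp-injective m {x} {y} e =
  trans (sym (transp-involutive m x)) (trans (cong (transp m) e) (transp-involutive m y))

transp-< : ∀ m n x → m < n → x < n → transp m x < n
transp-< m n x m<n x<n with x ≡ᵇ 0
... | true  = m<n
... | false with x ≡ᵇ m
...   | true  = ≤-<-trans z≤n m<n
...   | false = x<n

cnt-transp : ∀ n m f → 0 < m → m < n → cnt n (λ x → f (transp m x)) ≡ cnt n f
cnt-transp n m f 0<m m<n = +-cancelʳ-≡ (ind (f 0) + ind (f m)) _ _ (begin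
    cnt n (λ x → f (transp m x)) + (ind (f 0) + ind (f m))
  ≡⟨ sym (+-assoc _ (ind (f 0)) (ind (f m))) ⟩
    cnt n (λ x → f (transp m x)) + ind (f 0) + ind (f m)
  ≡⟨ cnt-update₂ n 0 m (λ x → f (transp m x)) f (≤-<-trans z≤n m<n) m<n (≢-sym (<⇒≢ 0<m))
       (λ i _ i≢0 i≢m → cong f (transp-id m i i≢0 i≢m)) ⟩
    cnt n f + ind (f (transp m 0)) + ind (f (transp m m))
  ≡⟨ cong (λ x → cnt n f + ind (f m) + ind (f x)) (transp-m m) ⟩
    cnt n f + ind (f m) + ind (f 0)
  ≡⟨ exchange (cnt n f) (ind (f m)) (ind (f 0)) ⟩
    cnt n f + (ind (f 0) + ind (f m)) ∎)
  where
  open ≡-Reasoning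
  exchange : ∀ x y z → x + y + z ≡ x + (z + y)
  exchange = solve-∀

addMod-% : ∀ n d .{{_ : NonZero d}} → d ∣ n → ∀ r c → addMod n r c % d ≡ (r + c) % d
addMod-% n d (divides q n≡qd) r c = begin
    addMod n r c % d
  ≡⟨ sym ([m+kn]%n≡m%n (addMod n r c) (q * wrap n r c) d) ⟩
    (addMod n r c + q * wrap n r c * d) % d
  ≡⟨ cong (λ z → (addMod n r c + z) % d) (trans (ar q (wrap n r c) d) (cong (_* wrap n r c) (sym n≡qd))) ⟩
    (addMod n r c + n * wrap n r c) % d
  ≡⟨ cong (_% d) (sym (addMod-decomp n r c)) ⟩
    (r + c) % d ∎
  where
  open ≡-Reasoning
  ar : ∀ q w d → q * w * d ≡ q * d * w
  ar = solve-∀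

module SwappedSquare (m n : ℕ) .{{_ : NonZero m}} (m<n : m < n) (m∣n : m ∣ n) where

  0<m : 0 < m
  0<m = >-nonZero⁻¹ m

  swapIf : Bool → ℕ → ℕ
  swapIf true  x = transp m x
  swapIf false x = x

  swapIf-id : ∀ b x → ¬ x ≡ 0 → ¬ x ≡ m → swapIf b x ≡ x
  swapIf-id true  x x≢0 x≢m = transp-id m x x≢0 x≢m
  swapIf-id false x _   _   = refl

  swapIf-injective : ∀ b {x y} → swapIf b x ≡ swapIf b y → x ≡ y
  swapIf-injective true  e = transp-injective m e
  swapIf-injective false e = e

  swapIf-< : ∀ b x → x < n → swapIf b x < n
  swapIf-< true  x x<n = transp-< m n x m<n x<n
  swapIf-< false x x<n = x<n

  cnt-swapIf : ∀ b f → cnt n (λ x → f (swapIf b x)) ≡ cnt n f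
  cnt-swapIf true  f = cnt-transp n m f 0<m m<n
  cnt-swapIf false f = refl

  onZeroLine : ℕ → Bool
  onZeroLine x = x % m ≡ᵇ 0

  E : ℕ → ℕ → ℕ
  E r c = swapIf (onZeroLine r) (addMod n r c)

  special-cell : ∀ r c → addMod n r c ≡ 0 ⊎ addMod n r c ≡ m → onZeroLine r ≡ onZeroLine c
  special-cell r c special = beq-iff (%-zero-cancelˡ m r c r+c≡0) (%-zero-cancelˡ m c r c+r≡0)
    where
    special-%m : ∀ {a} → a ≡ 0 ⊎ a ≡ m → a % m ≡ 0
    special-%m (inj₁ refl) = m*n%n≡0 0 m
    special-%m (inj₂ refl) = n%n≡0 m
    r+c≡0 : (r + c) % m ≡ 0
    r+c≡0 = trans (sym (addMod-% n m m∣n r c)) (special-%m special)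
    c+r≡0 : (c + r) % m ≡ 0
    c+r≡0 = trans (cong (_% m) (+-comm c r)) r+c≡0

  E-by-column : ∀ r c → E r c ≡ swapIf (onZeroLine c) (addMod n r c)
  E-by-column r c with addMod n r c ≟ℕ 0 | addMod n r c ≟ℕ m
  ... | yes a≡0 | _       = cong (λ b → swapIf b (addMod n r c)) (special-cell r c (inj₁ a≡0))
  ... | no _    | yes a≡m = cong (λ b → swapIf b (addMod n r c)) (special-cell r c (inj₂ a≡m))
  ... | no a≢0  | no a≢m  = trans (swapIf-id (onZeroLine r) _ a≢0 a≢m) (sym (swapIf-id (onZeroLine c) _ a≢0 a≢m))

  E-< : ∀ r c → r < n → c < n → E r c < n
  E-< r c r<n c<n = swapIf-< (onZeroLine r) _ (addMod-< n r c r<n c<n)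

  E-row-injective : ∀ r {c c'} → c < n → c' < n → E r c ≡ E r c' → c ≡ c'
  E-row-injective r c<n c'<n e = addMod-injective n r c<n c'<n (swapIf-injective (onZeroLine r) e)

  E-col-injective : ∀ c {r r'} → r < n → r' < n → E r c ≡ E r' c → r ≡ r'
  E-col-injective c {r} {r'} r<n r'<n e = addMod-injective n c r<n r'<n
    (trans (addMod-comm n c r) (trans (swapIf-injective (onZeroLine c)
      (trans (sym (E-by-column r c)) (trans e (E-by-column r' c)))) (addMod-comm n r' c)))

  entryF : Fin n → Fin n → Fin n
  entryF r c = fromℕ< (E-< (toℕ r) (toℕ c) (toℕ<n r) (toℕ<n c))

  toℕ-entryF : ∀ r c → toℕ (entryF r c) ≡ E (toℕ r) (toℕ c)
  toℕ-entryF r c = toℕ-fromℕ< _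

  square : LatinSquare n
  square = record
    { entry  = entryF
    ; rowInj = λ r {c} {c'} e → toℕ-injective (E-row-injective (toℕ r) (toℕ<n c) (toℕ<n c')
          (trans (sym (toℕ-entryF r c)) (trans (cong toℕ e) (toℕ-entryF r c'))))
    ; colInj = λ c {r} {r'} e → toℕ-injective (E-col-injective (toℕ c) (toℕ<n r) (toℕ<n r')
          (trans (sym (toℕ-entryF r c)) (trans (cong toℕ e) (toℕ-entryF r' c))))
    }

  cnt-row : ∀ r f → r < n → cnt n (λ c → f (E r c)) ≡ cnt n f
  cnt-row r f r<n = trans (cnt-rotate n r (λ x → f (swapIf (onZeroLine r) x)) (<⇒≤ r<n))
                          (cnt-swapIf (onZeroLine r) f)

  raised lowered : ℕ → ℕ → Bool
  raised  r c = onZeroLine r ∧ (addMod n r c ≡ᵇ 0)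
  lowered r c = onZeroLine r ∧ (addMod n r c ≡ᵇ m)

  raised⇒m : ∀ r c → raised r c ≡ true → E r c ≡ m
  raised⇒m r c h with onZeroLine r
  ... | true rewrite beq-true (addMod n r c) 0 h = refl

  lowered⇒0 : ∀ r c → lowered r c ≡ true → E r c ≡ 0
  lowered⇒0 r c h with onZeroLine r
  ... | true rewrite beq-true (addMod n r c) m h = transp-m m

  swapIf-shift : ∀ b a → a + m * ind (b ∧ (a ≡ᵇ 0)) ≡ swapIf b a + m * ind (b ∧ (a ≡ᵇ m))
  swapIf-shift false a = refl
  swapIf-shift true a with a ≟ℕ 0 | a ≟ℕ m
  ... | yes refl | _ rewrite beq-false 0 m (≢-sym (≢-nonZero⁻¹ m)) = ar m
    where ar : ∀ m → m * 1 ≡ m + m * 0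
          ar = solve-∀
  ... | no a≢0 | yes refl rewrite beq-false a 0 a≢0 | beq-refl a = ar a
    where ar : ∀ a → a + a * 0 ≡ a * 1
          ar = solve-∀
  ... | no a≢0 | no a≢m rewrite beq-false a 0 a≢0 | beq-false a m a≢m = refl

  cell-identity : ∀ r c →
    r + c + m * ind (raised r c) ≡ E r c + n * wrap n r c + m * ind (lowered r c)
  cell-identity r c = begin
      r + c + m * ind (raised r c)
    ≡⟨ cong (_+ m * ind (raised r c)) (addMod-decomp n r c) ⟩
      addMod n r c + n * wrap n r c + m * ind (raised r c)
    ≡⟨ exchange (addMod n r c) _ _ ⟩
      addMod n r c + m * ind (raised r c) + n * wrap n r c
    ≡⟨ cong (_+ n * wrap n r c) (swapIf-shift (onZeroLine r) (addMod n r c)) ⟩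
      E r c + m * ind (lowered r c) + n * wrap n r c
    ≡⟨ exchange (E r c) _ _ ⟩
      E r c + n * wrap n r c + m * ind (lowered r c) ∎
    where
    open ≡-Reasoning
    exchange : ∀ x y z → x + y + z ≡ x + z + y
    exchange = solve-∀

-- 2K·X + p and 2K·Y + K + q differ when p, q < K: their residues mod 2K lie in different halves.
halves-differ : ∀ K X Y p q → p < K → q < K → ¬ 2 * K * X + p ≡ 2 * K * Y + K + q
halves-differ K X Y p q p<K q<K e with X ≤? Y
... | yes X≤Y = <⇒≱ lower (≤-reflexive (sym e))
  where
  lower : 2 * K * X + p < 2 * K * Y + K + q
  lower = begin-strict
      2 * K * X + p     <⟨ +-monoʳ-< (2 * K * X) p<K ⟩
      2 * K * X + K     ≤⟨ +-monoˡ-≤ K (*-monoʳ-≤ (2 * K) X≤Y) ⟩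
      2 * K * Y + K     ≤⟨ m≤m+n _ q ⟩
      2 * K * Y + K + q ∎
    where open ≤-Reasoning
... | no X≰Y = <⇒≱ higher (≤-reflexive e)
  where
  higher : 2 * K * Y + K + q < 2 * K * X + p
  higher = begin-strict
      2 * K * Y + K + q     ≡⟨ +-assoc (2 * K * Y) K q ⟩
      2 * K * Y + (K + q)   <⟨ +-monoʳ-< (2 * K * Y) (+-monoʳ-< K q<K) ⟩
      2 * K * Y + (K + K)   ≡⟨ ar K Y ⟩
      2 * K * suc Y         ≤⟨ *-monoʳ-≤ (2 * K) (≰⇒> X≰Y) ⟩
      2 * K * X             ≤⟨ m≤m+n _ p ⟩
      2 * K * X + p         ∎
    where open ≤-Reasoning
          ar : ∀ K Y → 2 * K * Y + (K + K) ≡ 2 * K * suc Y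
          ar = solve-∀

-- With n = 2km, T = 0 + 1 + … + (n-1),
-- c = 2a + 1 < k and p, q ≤ c, the balance  c·T + m·p = n·W + m·q  is impossible:
-- it says m·(p - q) ≡ c·k·m ≡ k·m (mod 2km), i.e. p - q ≡ k (mod 2k).
odd-balance-impossible : ∀ k m a T W p q → .{{NonZero m}} → let n = 2 * k * m; c = suc (2 * a) in
  c < k → p ≤ c → q ≤ c → 2 * T + n ≡ n * n → c * T + m * p ≡ n * W + m * q → ⊥
odd-balance-impossible k m a T W p q c<k p≤c q≤c gauss-eq balance =
  halves-differ k (c * k * m) (W + a) p q (≤-<-trans p≤c c<k) (≤-<-trans q≤c c<k) shifted
  where
  open ≡-Reasoning
  c = suc (2 * a)
  doubled : 2 * m * (c * k * (2 * k * m) + p) ≡ 2 * m * (2 * k * W + c * k + q)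
  doubled = begin
      2 * m * (c * k * (2 * k * m) + p)
    ≡⟨ a1 k m c p ⟩
      c * ((2 * k * m) * (2 * k * m)) + 2 * (m * p)
    ≡⟨ cong (λ z → c * z + 2 * (m * p)) (sym gauss-eq) ⟩
      c * (2 * T + 2 * k * m) + 2 * (m * p)
    ≡⟨ a2 k m c T p ⟩
      2 * (c * T + m * p) + c * (2 * k * m)
    ≡⟨ cong (λ z → 2 * z + c * (2 * k * m)) balance ⟩
      2 * (2 * k * m * W + m * q) + c * (2 * k * m)
    ≡⟨ a3 k m c W q ⟩
      2 * m * (2 * k * W + c * k + q) ∎
    where
    a1 : ∀ k m c p → 2 * m * (c * k * (2 * k * m) + p) ≡ c * ((2 * k * m) * (2 * k * m)) + 2 * (m * p)
    a1 = solve-∀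
    a2 : ∀ k m c T p → c * (2 * T + 2 * k * m) + 2 * (m * p) ≡ 2 * (c * T + m * p) + c * (2 * k * m)
    a2 = solve-∀
    a3 : ∀ k m c W q → 2 * (2 * k * m * W + m * q) + c * (2 * k * m) ≡ 2 * m * (2 * k * W + c * k + q)
    a3 = solve-∀
  shifted : 2 * k * (c * k * m) + p ≡ 2 * k * (W + a) + k + q
  shifted = begin
      2 * k * (c * k * m) + p     ≡⟨ b1 c k m p ⟩
      c * k * (2 * k * m) + p     ≡⟨ *-cancelˡ-≡ _ _ (2 * m) {{m*n≢0 2 m}} doubled ⟩
      2 * k * W + c * k + q       ≡⟨ b2 a k W q ⟩
      2 * k * (W + a) + k + q     ∎
    where
    b1 : ∀ c k m p → 2 * k * (c * k * m) + p ≡ c * k * (2 * k * m) + p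
    b1 = solve-∀
    b2 : ∀ a k W q → 2 * k * W + suc (2 * a) * k + q ≡ 2 * k * (W + a) + k + q
    b2 = solve-∀

-- Summing the cell identity over the entries of a c-plex, the row, column and symbol
-- sums all equal c·T, leaving the impossible balance above, where p and q count the
-- raised and lowered entries (at most c each, since they carry the symbols m and 0).
module NoOddPlex (k m : ℕ) .{{_ : NonZero k}} .{{_ : NonZero m}} where

  n : ℕ
  n = 2 * k * m

  m<n : m < n
  m<n = begin-strict
      m           <⟨ m<m+n m (>-nonZero⁻¹ m) ⟩
      m + m       ≡⟨ cong (m +_) (sym (+-identityʳ m)) ⟩
      2 * m       ≤⟨ *-monoˡ-≤ m (*-monoʳ-≤ 2 (>-nonZero⁻¹ k)) ⟩
      2 * k * m   ∎
    where open ≤-Reasoning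

  open SwappedSquare m n m<n (divides (2 * k) refl) public

  module PlexBalance (c : ℕ) (P : EntrySet n) (plex : IsPlex c square P) where
    open PlexSums square c P plex

    raisedF loweredF wrapF : Fin n → Fin n → ℕ
    raisedF  r col = ind (raised  (toℕ r) (toℕ col))
    loweredF r col = ind (lowered (toℕ r) (toℕ col))
    wrapF    r col = wrap n (toℕ r) (toℕ col)

    raised-bound : ΣP raisedF ≤ c
    raised-bound = symbol-bound (fromℕ< m<n) (λ r col → raised (toℕ r) (toℕ col))
      (λ r col h → toℕ-injective (trans (toℕ-entryF r col)
         (trans (raised⇒m (toℕ r) (toℕ col) h) (sym (toℕ-fromℕ< m<n)))))

    lowered-bound : ΣP loweredF ≤ c
    lowered-bound = symbol-bound (fromℕ< 0<n) (λ r col → lowered (toℕ r) (toℕ col))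
      (λ r col h → toℕ-injective (trans (toℕ-entryF r col)
         (trans (lowered⇒0 (toℕ r) (toℕ col) h) (sym (toℕ-fromℕ< 0<n)))))
      where 0<n = ≤-<-trans z≤n m<n

    summed-identity :
      ΣP (λ r _ → toℕ r) + ΣP (λ _ col → toℕ col) + m * ΣP raisedF ≡
      ΣP (λ r col → toℕ (entryF r col)) + n * ΣP wrapF + m * ΣP loweredF
    summed-identity = begin
        ΣP (λ r _ → toℕ r) + ΣP (λ _ col → toℕ col) + m * ΣP raisedF
      ≡⟨ cong₂ _+_ (sym (ΣP-+ _ _)) (sym (ΣP-* m raisedF)) ⟩
        ΣP (λ r col → toℕ r + toℕ col) + ΣP (λ r col → m * raisedF r col)
      ≡⟨ sym (ΣP-+ _ _) ⟩
        ΣP (λ r col → toℕ r + toℕ col + m * raisedF r col)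
      ≡⟨ ΣP-ext (λ r col → trans (cell-identity (toℕ r) (toℕ col))
           (cong (λ z → z + n * wrapF r col + m * loweredF r col) (sym (toℕ-entryF r col)))) ⟩
        ΣP (λ r col → toℕ (entryF r col) + n * wrapF r col + m * loweredF r col)
      ≡⟨ ΣP-+ _ _ ⟩
        ΣP (λ r col → toℕ (entryF r col) + n * wrapF r col) + ΣP (λ r col → m * loweredF r col)
      ≡⟨ cong₂ _+_ (trans (ΣP-+ _ _) (cong (ΣP (λ r col → toℕ (entryF r col)) +_) (ΣP-* n wrapF)))
                   (ΣP-* m loweredF) ⟩
        ΣP (λ r col → toℕ (entryF r col)) + n * ΣP wrapF + m * ΣP loweredF ∎
      where open ≡-Reasoning

    balance : c * sumFin n toℕ + m * ΣP raisedF ≡ n * ΣP wrapF + m * ΣP loweredF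
    balance = +-cancelˡ-≡ cT _ _ (begin
        cT + (cT + m * ΣP raisedF)      ≡⟨ sym (+-assoc cT cT _) ⟩
        cT + cT + m * ΣP raisedF        ≡⟨ cong₂ (λ x y → x + y + m * ΣP raisedF) (sym ΣP-rows) (sym ΣP-cols) ⟩
        ΣP (λ r _ → toℕ r) + ΣP (λ _ col → toℕ col) + m * ΣP raisedF
                                        ≡⟨ summed-identity ⟩
        ΣP (λ r col → toℕ (entryF r col)) + n * ΣP wrapF + m * ΣP loweredF
                                        ≡⟨ cong (λ x → x + n * ΣP wrapF + m * ΣP loweredF) ΣP-symbols ⟩
        cT + n * ΣP wrapF + m * ΣP loweredF
                                        ≡⟨ +-assoc cT _ _ ⟩
        cT + (n * ΣP wrapF + m * ΣP loweredF) ∎)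
      where
      open ≡-Reasoning
      cT = c * sumFin n toℕ

  no-odd-plex : ∀ c → Odd c → c < k → ¬ HasPlex c square
  no-odd-plex c (a , refl) c<k (P , plex) =
    odd-balance-impossible k m a (sumFin n toℕ) (ΣP wrapF) (ΣP raisedF) (ΣP loweredF)
      c<k raised-bound lowered-bound (gauss n) balance
    where open PlexBalance c P plex
          open PlexSums square c P plex

-- For k = 2j + 1 and M = 2m (so n = k·M), every symbol s gets a label
-- λ(s) ∈ [0, M): writing s = q·M + 2i + b (i < m, b < 2),
--   λ(s) = i + m·[b ≠ parity of q].
-- Every label is used by exactly k symbols (one per block of M symbols), and the
-- k-plex will consist of the cells (r, c) with  r ≡ λ(E r c)  (mod M).
module Labels (j m : ℕ) .{{_ : NonZero m}} where

  k : ℕ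
  k = suc (2 * j)

  open NoOddPlex k m public

  M : ℕ
  M = 2 * m

  instance
    M-nonZero : NonZero M
    M-nonZero = m*n≢0 2 m

  M≡m+m : M ≡ m + m
  M≡m+m = cong (m +_) (+-identityʳ m)

  m<M : m < M
  m<M = subst (m <_) (sym M≡m+m) (m<m+n m 0<m)

  n≡kM : n ≡ k * M
  n≡kM = ar k m
    where ar : ∀ k m → 2 * k * m ≡ k * (2 * m)
          ar = solve-∀

  label : ℕ → ℕ
  label s = (s % M) / 2 + (if par (s % M) xor par (s / M) then m else 0)

  par-pair : ∀ i b → par (i * 2 + b) ≡ par b
  par-pair zero    b = refl
  par-pair (suc i) b = par-pair i b

  pair<M : ∀ i b → i < m → b < 2 → i * 2 + b < M
  pair<M i b i<m b<2 = begin-strict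
      i * 2 + b   <⟨ +-monoʳ-< (i * 2) b<2 ⟩
      i * 2 + 2   ≡⟨ +-comm (i * 2) 2 ⟩
      suc i * 2   ≤⟨ *-monoˡ-≤ 2 i<m ⟩
      m * 2       ≡⟨ *-comm m 2 ⟩
      M           ∎
    where open ≤-Reasoning

  label-pair : ∀ q i b → i < m → b < 2 → label (q * M + (i * 2 + b)) ≡ i + (if par b xor par q then m else 0)
  label-pair q i b i<m b<2
    rewrite block-mod M q (i * 2 + b) (pair<M i b i<m b<2) | block-div M q (i * 2 + b) (pair<M i b i<m b<2)
          | block-div 2 i b b<2 | par-pair i b = refl

  label-< : ∀ s → label s < M
  label-< s = bound (par (s % M) xor par (s / M))
    where
    half< : (s % M) / 2 < m
    half< = m<n*o⇒m/o<n (subst (s % M <_) (*-comm 2 m) (m%n<n s M))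
    bound : ∀ b → (s % M) / 2 + (if b then m else 0) < M
    bound true  = subst ((s % M) / 2 + m <_) (sym M≡m+m) (+-monoˡ-< m half<)
    bound false = subst (_< M) (sym (+-identityʳ _)) (<-trans half< m<M)

  cnt-pairs : ∀ g → cnt n g ≡
    sumℕ k (λ q → sumℕ m (λ i → ind (g (q * M + (i * 2 + 0))) + (ind (g (q * M + (i * 2 + 1))) + 0)))
  cnt-pairs g = trans (cong (λ z → cnt z g) n≡kM) (trans (cnt-block k M g)
    (sumℕ-ext k (λ q _ → trans (cong (λ z → cnt z (λ σ → g (q * M + σ))) (*-comm 2 m))
                               (cnt-block m 2 (λ σ → g (q * M + σ))))))

  sum-pairs : ∀ L f g → sumℕ L (λ i → ind (f i) + (ind (g i) + 0)) ≡ cnt L f + cnt L g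
  sum-pairs L f g = trans (sumℕ-ext L (λ i _ → cong (ind (f i) +_) (+-identityʳ (ind (g i)))))
     (trans (sumℕ-+ L (λ i → ind (f i)) (λ i → ind (g i))) (sym (cong₂ _+_ (cnt-sum L f) (cnt-sum L g))))

  two-windows : ∀ a → a < M → cnt m (λ i → a ≡ᵇ (i + 0)) + cnt m (λ i → a ≡ᵇ (i + m)) ≡ 1
  two-windows a a<M with a <? m
  ... | yes a<m = cong₂ _+_ (window-in m 0 a z≤n a<m) (window-out m m a (inj₁ a<m))
  ... | no a≮m  = cong₂ _+_ (window-out m 0 a (inj₂ (≮⇒≥ a≮m)))
                            (window-in m m a (≮⇒≥ a≮m) (subst (a <_) M≡m+m a<M))

  label-count : ∀ a → a < M → cnt n (λ x → a ≡ᵇ label x) ≡ k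
  label-count a a<M = trans (cnt-pairs (λ x → a ≡ᵇ label x))
    (trans (sumℕ-ext k (λ q _ → block q)) (trans (sumℕ-const k 1) (*-identityʳ k)))
    where
    by-parity : ∀ p → sumℕ m (λ i → ind (a ≡ᵇ (i + (if p then m else 0)))
                                   + (ind (a ≡ᵇ (i + (if not p then m else 0))) + 0)) ≡ 1
    by-parity false = trans (sum-pairs m _ _) (two-windows a a<M)
    by-parity true  = trans (sum-pairs m (λ i → a ≡ᵇ (i + m)) (λ i → a ≡ᵇ (i + 0)))
                              (trans (+-comm (cnt m (λ i → a ≡ᵇ (i + m))) _) (two-windows a a<M))
    block : ∀ q → sumℕ m (λ i → ind (a ≡ᵇ label (q * M + (i * 2 + 0)))
                             + (ind (a ≡ᵇ label (q * M + (i * 2 + 1))) + 0)) ≡ 1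
    block q = trans (sumℕ-ext m (λ i i<m → cong₂ (λ x y → ind (a ≡ᵇ x) + (ind (a ≡ᵇ y) + 0))
                      (label-pair q i 0 i<m (s≤s z≤n)) (label-pair q i 1 i<m (s≤s (s≤s z≤n)))))
                    (by-parity (par q))

  residue-count : ∀ a → a < M → cnt n (λ r → (r % M) ≡ᵇ a) ≡ k
  residue-count a a<M = trans (cong (λ z → cnt z (λ r → (r % M) ≡ᵇ a)) n≡kM)
    (trans (cnt-block k M (λ r → (r % M) ≡ᵇ a))
    (trans (sumℕ-ext k (λ q _ → trans (cnt-ext M (λ σ σ<M → cong (_≡ᵇ a) (block-mod M q σ σ<M)))
                                      (cnt-one M a a<M)))
    (trans (sumℕ-const k 1) (*-identityʳ k))))

  inPlex : ℕ → ℕ → Bool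
  inPlex r c = (r % M) ≡ᵇ label (E r c)

  row-count : ∀ r → r < n → cnt n (λ c → inPlex r c) ≡ k
  row-count r r<n = trans (cnt-row r (λ x → (r % M) ≡ᵇ label x) r<n) (label-count (r % M) (m%n<n r M))

  row-symbol-count : ∀ r s → r < n → s < n →
    cnt n (λ c → inPlex r c ∧ (E r c ≡ᵇ s)) ≡ ind ((r % M) ≡ᵇ label s)
  row-symbol-count r s r<n s<n = begin
      cnt n (λ c → inPlex r c ∧ (E r c ≡ᵇ s))
    ≡⟨ cnt-ext n (λ c _ → at-s c) ⟩
      cnt n (λ c → ((r % M) ≡ᵇ label s) ∧ (E r c ≡ᵇ s))
    ≡⟨ cnt-∧ˡ n _ (λ c → E r c ≡ᵇ s) ⟩
      ind ((r % M) ≡ᵇ label s) * cnt n (λ c → E r c ≡ᵇ s)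
    ≡⟨ cong (ind ((r % M) ≡ᵇ label s) *_) (trans (cnt-row r (_≡ᵇ s) r<n) (cnt-one n s s<n)) ⟩
      ind ((r % M) ≡ᵇ label s) * 1
    ≡⟨ *-identityʳ _ ⟩
      ind ((r % M) ≡ᵇ label s) ∎
    where
    open ≡-Reasoning
    at-s : ∀ c → (inPlex r c ∧ (E r c ≡ᵇ s)) ≡ (((r % M) ≡ᵇ label s) ∧ (E r c ≡ᵇ s))
    at-s c with E r c ≟ℕ s
    ... | yes e rewrite e | beq-refl s = refl
    ... | no ne rewrite beq-false (E r c) s ne | ∧-zeroʳ ((r % M) ≡ᵇ label (E r c))
                      | ∧-zeroʳ ((r % M) ≡ᵇ label s) = refl

-- Write x = addMod n r c.  By the column description of E and residue-test,
-- the cell (r, c) is in the plex iff  c ≡ x - λ(swap x)  (mod M),  where the swap is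
-- applied iff c is on a zero line.  Rotating r, the column count of c is therefore the
-- number of x < n whose offset  x - λ(swap x) mod M  equals c mod M.
module Offsets (j m : ℕ) .{{_ : NonZero m}} where

  open Labels j m public

  offset : Bool → ℕ → ℕ
  offset b x = ((x % M) + (M ∸ label (swapIf b x))) % M

  inPlex-by-column : ∀ r c → inPlex r c ≡ ((c % M) ≡ᵇ offset (onZeroLine c) (addMod n r c))
  inPlex-by-column r c = begin
      (r % M) ≡ᵇ label (E r c)
    ≡⟨ cong (λ z → (r % M) ≡ᵇ label z) (E-by-column r c) ⟩
      (r % M) ≡ᵇ label y
    ≡⟨ residue-test M (r % M) (c % M) (label y) (m%n<n r M) (m%n<n c M) (label-< y) ⟩
      (c % M) ≡ᵇ (((r % M + c % M) % M + (M ∸ label y)) % M)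
    ≡⟨ cong (λ z → (c % M) ≡ᵇ ((z + (M ∸ label y)) % M)) residue-sum ⟩
      (c % M) ≡ᵇ offset (onZeroLine c) (addMod n r c) ∎
    where
    open ≡-Reasoning
    y = swapIf (onZeroLine c) (addMod n r c)
    residue-sum : (r % M + c % M) % M ≡ addMod n r c % M
    residue-sum = trans (sym (%-distribˡ-+ r c M)) (sym (addMod-% n M (divides k n≡kM) r c))

  column-as-offsets : ∀ c → c < n →
    cnt n (λ r → inPlex r c) ≡ cnt n (λ x → (c % M) ≡ᵇ offset (onZeroLine c) x)
  column-as-offsets c c<n =
    trans (cnt-ext n (λ r _ → trans (inPlex-by-column r c)
                                    (cong (λ z → (c % M) ≡ᵇ offset (onZeroLine c) z) (addMod-comm n r c))))
          (cnt-rotate n c (λ x → (c % M) ≡ᵇ offset (onZeroLine c) x) (<⇒≤ c<n))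

  M∸[i+m] : ∀ i → M ∸ (i + m) ≡ m ∸ i
  M∸[i+m] i = trans (cong₂ _∸_ M≡m+m (+-comm i m)) ([m+n]∸[m+o]≡n∸o m m i)

  offset-pair : ∀ q i b → i < m → b < 2 →
    offset false (q * M + (i * 2 + b)) ≡ (i + b + (if par b xor par q then m else M)) % M
  offset-pair q i b i<m b<2 = cong (_% M) (trans
    (cong₂ (λ x y → x + (M ∸ y)) (block-mod M q (i * 2 + b) (pair<M i b i<m b<2)) (label-pair q i b i<m b<2))
    (subtract-label (par b xor par q)))
    where
    sub : ∀ X → i ≤ X → i * 2 + b + (X ∸ i) ≡ i + b + X
    sub X i≤X = trans (ar i b (X ∸ i)) (cong (i + b +_) (m+[n∸m]≡n i≤X))
      where ar : ∀ i b y → i * 2 + b + y ≡ i + b + (i + y)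
            ar = solve-∀
    subtract-label : ∀ B → i * 2 + b + (M ∸ (i + (if B then m else 0))) ≡ i + b + (if B then m else M)
    subtract-label true  = trans (cong (i * 2 + b +_) (M∸[i+m] i)) (sub m (<⇒≤ i<m))
    subtract-label false = trans (cong (λ z → i * 2 + b + (M ∸ z)) (+-identityʳ i))
                                 (sub M (<⇒≤ (<-trans i<m m<M)))

  -- How often the value a occurs as an unswapped offset in an even resp. odd block.
  evenBlock oddBlock : ℕ → ℕ
  evenBlock a = cnt m (λ i → a ≡ᵇ (i + 0)) + cnt m (λ i → a ≡ᵇ ((i + 1 + m) % M))
  oddBlock  a = cnt m (λ i → a ≡ᵇ (i + m)) + cnt m (λ i → a ≡ᵇ (i + 1))

  offset-even : ∀ q i → par q ≡ false → i < m →
    offset false (q * M + (i * 2 + 0)) ≡ i + 0 × offset false (q * M + (i * 2 + 1)) ≡ (i + 1 + m) % M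
  offset-even q i even i<m rewrite offset-pair q i 0 i<m z<s | offset-pair q i 1 i<m (s<s z<s) | even =
    plusM-mod M (i + 0) (subst (_< M) (sym (+-identityʳ i)) (<-trans i<m m<M)) , refl

  offset-odd : ∀ q i → par q ≡ true → i < m →
    offset false (q * M + (i * 2 + 0)) ≡ i + m × offset false (q * M + (i * 2 + 1)) ≡ i + 1
  offset-odd q i odd i<m rewrite offset-pair q i 0 i<m z<s | offset-pair q i 1 i<m (s<s z<s) | odd =
    trans (cong (λ z → (z + m) % M) (+-identityʳ i)) (m<n⇒m%n≡m (subst (i + m <_) (sym M≡m+m) (+-monoˡ-< m i<m))) ,
    plusM-mod M (i + 1) (subst (_< M) (+-comm 1 i) (≤-<-trans i<m m<M))

  offset-block : ∀ a q →
    sumℕ m (λ i → ind (a ≡ᵇ offset false (q * M + (i * 2 + 0)))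
                + (ind (a ≡ᵇ offset false (q * M + (i * 2 + 1))) + 0))
    ≡ (if par q then oddBlock a else evenBlock a)
  offset-block a q with par q in parity
  ... | false = trans (sumℕ-ext m (λ i i<m → cong₂ pair-hits (proj₁ (offset-even q i parity i<m))
                                                              (proj₂ (offset-even q i parity i<m))))
                      (sum-pairs m _ _)
    where pair-hits = λ x y → ind (a ≡ᵇ x) + (ind (a ≡ᵇ y) + 0)
  ... | true  = trans (sumℕ-ext m (λ i i<m → cong₂ pair-hits (proj₁ (offset-odd q i parity i<m))
                                                              (proj₂ (offset-odd q i parity i<m))))
                      (sum-pairs m _ _)
    where pair-hits = λ x y → ind (a ≡ᵇ x) + (ind (a ≡ᵇ y) + 0)

  -- Of the k = 2j + 1 blocks, j + 1 are even and j are odd.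
  offset-count : ∀ a → cnt n (λ x → a ≡ᵇ offset false x) ≡ suc j * evenBlock a + j * oddBlock a
  offset-count a = trans (cnt-pairs (λ x → a ≡ᵇ offset false x))
    (sumℕ-parity j _ (evenBlock a) (oddBlock a) (offset-block a))

  m₁ : ℕ
  m₁ = pred m

  m₁+1≡m : m₁ + 1 ≡ m
  m₁+1≡m = trans (+-comm m₁ 1) (suc-pred m)

  wrapped-window : ∀ a → cnt m (λ i → a ≡ᵇ ((i + 1 + m) % M)) ≡ cnt m₁ (λ i → a ≡ᵇ (i + suc m)) + ind (a ≡ᵇ 0)
  wrapped-window a = begin
      cnt m f
    ≡⟨ cong (λ z → cnt z f) (sym m₁+1≡m) ⟩
      cnt (m₁ + 1) f
    ≡⟨ cnt-split m₁ 1 f ⟩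
      cnt m₁ f + (ind (f (m₁ + 0)) + 0)
    ≡⟨ cong₂ _+_ (cnt-ext m₁ (λ i i<m₁ → cong (a ≡ᵇ_) (below i i<m₁)))
                 (trans (+-identityʳ _) (cong (λ z → ind (a ≡ᵇ z)) last)) ⟩
      cnt m₁ (λ i → a ≡ᵇ (i + suc m)) + ind (a ≡ᵇ 0) ∎
    where
    open ≡-Reasoning
    f = λ i → a ≡ᵇ ((i + 1 + m) % M)
    below : ∀ i → i < m₁ → (i + 1 + m) % M ≡ i + suc m
    below i i<m₁ = trans (m<n⇒m%n≡m (subst (i + 1 + m <_) (sym M≡m+m)
                     (+-monoˡ-< m (subst (i + 1 <_) m₁+1≡m (+-monoˡ-< 1 i<m₁)))))
                   (+-assoc i 1 m)
    last : (m₁ + 0 + 1 + m) % M ≡ 0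
    last = trans (cong (λ z → (z + m) % M) (trans (cong (_+ 1) (+-identityʳ m₁)) m₁+1≡m))
                 (trans (cong (_% M) (sym M≡m+m)) (n%n≡0 M))


  evenBlock-window : ∀ a → evenBlock a ≡ cnt m (λ i → a ≡ᵇ (i + 0)) + (cnt m₁ (λ i → a ≡ᵇ (i + suc m)) + ind (a ≡ᵇ 0))
  evenBlock-window a = cong (cnt m (λ i → a ≡ᵇ (i + 0)) +_) (wrapped-window a)

  blocks-at-0 : evenBlock 0 ≡ 2 × oddBlock 0 ≡ 0
  blocks-at-0 =
    trans (evenBlock-window 0)
      (cong₂ _+_ (window-in m 0 0 z≤n 0<m) (cong (_+ 1) (window-out m₁ (suc m) 0 (inj₁ z<s)))) ,
    cong₂ _+_ (window-out m m 0 (inj₁ 0<m)) (window-out m 1 0 (inj₁ z<s))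

  blocks-at-m : evenBlock m ≡ 0 × oddBlock m ≡ 2
  blocks-at-m =
    trans (evenBlock-window m)
      (cong₂ _+_ (window-out m 0 m (inj₂ ≤-refl))
                 (cong₂ _+_ (window-out m₁ (suc m) m (inj₁ (n<1+n m)))
                            (cong ind (beq-false m 0 (≢-nonZero⁻¹ m))))) ,
    cong₂ _+_ (window-in m m m ≤-refl (m<m+n m 0<m)) (window-in m 1 m 0<m (n<1+n m))

  blocks-generic : ∀ a → a < M → ¬ a ≡ 0 → ¬ a ≡ m → evenBlock a ≡ 1 × oddBlock a ≡ 1
  blocks-generic a a<M a≢0 a≢m with a <? m
  ... | yes a<m =
    trans (evenBlock-window a)
      (cong₂ _+_ (window-in m 0 a z≤n a<m)
                 (cong₂ _+_ (window-out m₁ (suc m) a (inj₁ (<-trans a<m (n<1+n m))))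
                            (cong ind (beq-false a 0 a≢0)))) ,
    cong₂ _+_ (window-out m m a (inj₁ a<m)) (window-in m 1 a (n≢0⇒n>0 a≢0) (s≤s (<⇒≤ a<m)))
  ... | no a≮m =
    trans (evenBlock-window a)
      (cong₂ _+_ (window-out m 0 a (inj₂ (<⇒≤ m<a)))
                 (cong₂ _+_ (window-in m₁ (suc m) a m<a (subst (a <_) M≡sm+m₁ a<M))
                            (cong ind (beq-false a 0 a≢0)))) ,
    cong₂ _+_ (window-in m m a (<⇒≤ m<a) (subst (a <_) M≡m+m a<M)) (window-out m 1 a (inj₂ m<a))
    where
    m<a : m < a
    m<a = ≤∧≢⇒< (≮⇒≥ a≮m) (≢-sym a≢m)
    M≡sm+m₁ : M ≡ suc m + m₁
    M≡sm+m₁ = trans M≡m+m (trans (cong (m +_) (sym m₁+1≡m)) (trans (cong (m +_) (+-comm m₁ 1)) (+-suc m m₁)))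

  offset-count-0 : cnt n (λ x → 0 ≡ᵇ offset false x) ≡ suc k
  offset-count-0 with blocks-at-0
  ... | e , o rewrite offset-count 0 | e | o = ar j
    where ar : ∀ x → (1 + x) * 2 + x * 0 ≡ 2 + 2 * x
          ar = solve-∀

  offset-count-m : suc (cnt n (λ x → m ≡ᵇ offset false x)) ≡ k
  offset-count-m with blocks-at-m
  ... | e , o rewrite offset-count m | e | o = ar j
    where ar : ∀ x → 1 + ((1 + x) * 0 + x * 2) ≡ 1 + 2 * x
          ar = solve-∀

  offset-count-generic : ∀ a → a < M → ¬ a ≡ 0 → ¬ a ≡ m → cnt n (λ x → a ≡ᵇ offset false x) ≡ k
  offset-count-generic a a<M a≢0 a≢m with blocks-generic a a<M a≢0 a≢m
  ... | e , o rewrite offset-count a | e | o = ar j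
    where ar : ∀ x → (1 + x) * 1 + x * 1 ≡ 1 + 2 * x
          ar = solve-∀

-- In a column on a zero line the offsets are taken after exchanging 0 and m,
-- which changes them only at x = 0 and x = m.  There the unswapped offsets are 0 and a
-- value off {0, m}, the swapped ones a value off {0, m} and m; this moves one occurrence
-- from 0 to m and repairs the counts k + 1 and k - 1 to k.  With h = ⌊m/2⌋ ≥ 1 the values
-- off {0, m} that occur are m - h and 2m - h.
module KPlex (j m : ℕ) .{{_ : NonZero m}} (2≤m : 2 ≤ m) where

  open Offsets j m public

  h : ℕ
  h = m / 2

  1≤h : 1 ≤ h
  1≤h = m≥n⇒m/n>0 2≤m

  h<m : h < m
  h<m = m/n<m m 2 (s≤s (s≤s z≤n))

  Exceptional : ℕ → Set
  Exceptional v = v ≡ m ∸ h ⊎ v ≡ M ∸ h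

  M∸h≡m+[m∸h] : M ∸ h ≡ m + (m ∸ h)
  M∸h≡m+[m∸h] = trans (cong (_∸ h) M≡m+m) (+-∸-assoc m (<⇒≤ h<m))

  exceptional-avoids : ∀ {v} → Exceptional v → ¬ v ≡ 0 × ¬ v ≡ m
  exceptional-avoids (inj₁ refl) = m>n⇒m∸n≢0 h<m , <⇒≢ (∸-monoʳ-< 1≤h (<⇒≤ h<m))
  exceptional-avoids (inj₂ refl) =
    (λ e → ≢-nonZero⁻¹ m (m+n≡0⇒m≡0 m (trans (sym M∸h≡m+[m∸h]) e))) ,
    (λ e → m>n⇒m∸n≢0 h<m (+-cancelˡ-≡ m _ 0 (trans (sym M∸h≡m+[m∸h]) (trans e (sym (+-identityʳ m))))))

  0%M≡0 : 0 % M ≡ 0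
  0%M≡0 = m*n%n≡0 0 M

  0/M≡0 : 0 / M ≡ 0
  0/M≡0 = 0/n≡0 M

  label-0 : label 0 ≡ 0
  label-0 rewrite 0%M≡0 | 0/M≡0 = refl

  label-m : label m ≡ h + (if par m then m else 0)
  label-m rewrite m<n⇒m%n≡m m<M | m<n⇒m/n≡0 m<M with par m
  ... | true  = refl
  ... | false = refl

  m∸h<M : m ∸ h < M
  m∸h<M = ≤-<-trans (m∸n≤m m h) m<M

  M∸h<M : M ∸ h < M
  M∸h<M = ∸-monoʳ-< 1≤h (≤-trans (<⇒≤ h<m) (<⇒≤ m<M))

  offset-false-0 : offset false 0 ≡ 0
  offset-false-0 rewrite label-0 | 0%M≡0 = n%n≡0 M

  offset-true-m : offset true m ≡ m
  offset-true-m rewrite transp-m m | label-0 | m<n⇒m%n≡m m<M = plusM-mod M m m<M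

  offset-false-m : Exceptional (offset false m)
  offset-false-m rewrite label-m | m<n⇒m%n≡m m<M with par m
  ... | false = inj₁ (trans (cong (_% M) reorder) (plusM-mod M (m ∸ h) m∸h<M))
    where reorder : m + (M ∸ (h + 0)) ≡ m ∸ h + M
          reorder = trans (cong (λ z → m + (M ∸ z)) (+-identityʳ h))
                    (trans (cong (m +_) M∸h≡m+[m∸h]) (trans (sym (+-assoc m m (m ∸ h)))
                    (trans (cong (_+ (m ∸ h)) (sym M≡m+m)) (+-comm M (m ∸ h)))))
  ... | true  = inj₂ (trans (cong (_% M) reorder) (m<n⇒m%n≡m M∸h<M))
    where reorder : m + (M ∸ (h + m)) ≡ M ∸ h
          reorder = trans (cong (m +_) (M∸[i+m] h)) (sym M∸h≡m+[m∸h])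

  offset-true-0 : Exceptional (offset true 0)
  offset-true-0 rewrite label-m | 0%M≡0 with par m
  ... | false = inj₂ (trans (cong (λ z → (M ∸ z) % M) (+-identityʳ h)) (m<n⇒m%n≡m M∸h<M))
  ... | true  = inj₁ (trans (cong (_% M) (M∸[i+m] h)) (m<n⇒m%n≡m m∸h<M))

  offsets-agree : ∀ a x → x < n → ¬ x ≡ 0 → ¬ x ≡ m → (a ≡ᵇ offset true x) ≡ (a ≡ᵇ offset false x)
  offsets-agree a x _ x≢0 x≢m = cong (λ z → a ≡ᵇ ((x % M + (M ∸ label z)) % M)) (transp-id m x x≢0 x≢m)

  exchange-counts : ∀ a → cnt n (λ x → a ≡ᵇ offset true x) + ind (a ≡ᵇ offset false 0) + ind (a ≡ᵇ offset false m)
                        ≡ cnt n (λ x → a ≡ᵇ offset false x) + ind (a ≡ᵇ offset true 0) + ind (a ≡ᵇ offset true m)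
  exchange-counts a = cnt-update₂ n 0 m _ _ (≤-<-trans z≤n m<n) m<n (≢-nonZero⁻¹ m) (offsets-agree a)

  swapped-count-0 : cnt n (λ x → 0 ≡ᵇ offset true x) ≡ k
  swapped-count-0 = +-cancelʳ-≡ 1 _ _ (begin
      cnt n swapped + 1
    ≡⟨ sym (+-identityʳ _) ⟩
      cnt n swapped + 1 + 0
    ≡⟨ cong₂ (λ u v → cnt n swapped + ind u + ind v) (sym (cong (0 ≡ᵇ_) offset-false-0)) (sym plain-m) ⟩
      cnt n swapped + ind (0 ≡ᵇ offset false 0) + ind (0 ≡ᵇ offset false m)
    ≡⟨ exchange-counts 0 ⟩
      cnt n plain + ind (0 ≡ᵇ offset true 0) + ind (0 ≡ᵇ offset true m)
    ≡⟨ cong₂ (λ u v → cnt n plain + ind u + ind v) swapped-0 (trans (cong (0 ≡ᵇ_) offset-true-m) (beq-false 0 m (≢-sym (≢-nonZero⁻¹ m)))) ⟩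
      cnt n plain + 0 + 0
    ≡⟨ trans (+-identityʳ _) (+-identityʳ _) ⟩
      cnt n plain
    ≡⟨ offset-count-0 ⟩
      suc k
    ≡⟨ +-comm 1 k ⟩
      k + 1 ∎)
    where
    open ≡-Reasoning
    swapped = λ x → 0 ≡ᵇ offset true x
    plain = λ x → 0 ≡ᵇ offset false x
    plain-m : (0 ≡ᵇ offset false m) ≡ false
    plain-m = beq-false 0 _ (λ e → proj₁ (exceptional-avoids offset-false-m) (sym e))
    swapped-0 : (0 ≡ᵇ offset true 0) ≡ false
    swapped-0 = beq-false 0 _ (λ e → proj₁ (exceptional-avoids offset-true-0) (sym e))

  swapped-count-m : cnt n (λ x → m ≡ᵇ offset true x) ≡ k
  swapped-count-m = begin
      cnt n swapped
    ≡⟨ sym (trans (+-identityʳ _) (+-identityʳ _)) ⟩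
      cnt n swapped + 0 + 0
    ≡⟨ cong₂ (λ u v → cnt n swapped + ind u + ind v) (sym plain-0) (sym plain-m) ⟩
      cnt n swapped + ind (m ≡ᵇ offset false 0) + ind (m ≡ᵇ offset false m)
    ≡⟨ exchange-counts m ⟩
      cnt n plain + ind (m ≡ᵇ offset true 0) + ind (m ≡ᵇ offset true m)
    ≡⟨ cong₂ (λ u v → cnt n plain + ind u + ind v) swapped-0 (trans (cong (m ≡ᵇ_) offset-true-m) (beq-refl m)) ⟩
      cnt n plain + 0 + 1
    ≡⟨ trans (cong (_+ 1) (+-identityʳ _)) (+-comm _ 1) ⟩
      suc (cnt n plain)
    ≡⟨ offset-count-m ⟩
      k ∎
    where
    open ≡-Reasoning
    swapped = λ x → m ≡ᵇ offset true x
    plain = λ x → m ≡ᵇ offset false x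
    plain-0 : (m ≡ᵇ offset false 0) ≡ false
    plain-0 = trans (cong (m ≡ᵇ_) offset-false-0) (beq-false m 0 (≢-nonZero⁻¹ m))
    plain-m : (m ≡ᵇ offset false m) ≡ false
    plain-m = beq-false m _ (λ e → proj₂ (exceptional-avoids offset-false-m) (sym e))
    swapped-0 : (m ≡ᵇ offset true 0) ≡ false
    swapped-0 = beq-false m _ (λ e → proj₂ (exceptional-avoids offset-true-0) (sym e))

  zero-line-residue : ∀ x → x < M → x % m ≡ 0 → x ≡ 0 ⊎ x ≡ m
  zero-line-residue x x<M x%m≡0 with x <? m
  ... | yes x<m = inj₁ (trans (sym (m<n⇒m%n≡m x<m)) x%m≡0)
  ... | no x≮m  = inj₂ (≤-antisym x≤m (≮⇒≥ x≮m))
    where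
    x∸m<m : x ∸ m < m
    x∸m<m = +-cancelʳ-< m (x ∸ m) m (subst (_< m + m) (sym (m∸n+n≡m (≮⇒≥ x≮m))) (subst (x <_) M≡m+m x<M))
    x∸m≡0 : x ∸ m ≡ 0
    x∸m≡0 = trans (sym (m<n⇒m%n≡m x∸m<m)) (trans (sym ([m+n]%n≡m%n (x ∸ m) m))
              (trans (cong (_% m) (m∸n+n≡m (≮⇒≥ x≮m))) x%m≡0))
    x≤m : x ≤ m
    x≤m = subst (_≤ m) (m∸n+n≡m (≮⇒≥ x≮m)) (subst (λ z → z + m ≤ m) (sym x∸m≡0) ≤-refl)

  -- A column off the zero lines has a residue other than 0, m and sees unswapped offsets;
  -- a zero-line column has residue 0 or m and sees swapped offsets.
  column-count : ∀ c → c < n → cnt n (λ r → inPlex r c) ≡ k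
  column-count c c<n = trans (column-as-offsets c c<n) (by-line (onZeroLine c) refl)
    where
    c%M%m : c % M % m ≡ c % m
    c%M%m = m∣n⇒o%n%m≡o%m m M c (divides 2 refl)
    by-line : ∀ b → onZeroLine c ≡ b → cnt n (λ x → (c % M) ≡ᵇ offset b x) ≡ k
    by-line false off = offset-count-generic (c % M) (m%n<n c M) (λ e → on-line (trans (cong (_% m) e) 0%m))
      (λ e → on-line (trans (cong (_% m) e) (n%n≡0 m)))
      where
      0%m : 0 % m ≡ 0
      0%m = m*n%n≡0 0 m
      on-line : c % M % m ≡ 0 → ⊥
      on-line e with trans (sym off) (beq-eq (trans (sym c%M%m) e))
      ... | ()
    by-line true on with zero-line-residue (c % M) (m%n<n c M) (trans c%M%m (beq-true (c % m) 0 on))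
    ... | inj₁ e rewrite e = swapped-count-0
    ... | inj₂ e rewrite e = swapped-count-m

  plexSet : EntrySet n
  plexSet r c = inPlex (toℕ r) (toℕ c)

  rows-k : ∀ r → count n (λ c → plexSet r c) ≡ k
  rows-k r = trans (count-toℕ n (λ c → inPlex (toℕ r) c)) (row-count (toℕ r) (toℕ<n r))

  columns-k : ∀ c → count n (λ r → plexSet r c) ≡ k
  columns-k c = trans (count-toℕ n (λ r → inPlex r (toℕ c))) (column-count (toℕ c) (toℕ<n c))

  symbols-k : ∀ s → sumFin n (λ r → count n (λ c → plexSet r c ∧ ⌊ entryF r c ≟ s ⌋)) ≡ k
  symbols-k s = begin
      sumFin n (λ r → count n (λ c → plexSet r c ∧ ⌊ entryF r c ≟ s ⌋))
    ≡⟨ sumFin-ext n (λ r → trans (count-ext n (λ c → cong (plexSet r c ∧_)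
         (trans (≟-as-≡ᵇ (entryF r c) s) (cong (_≡ᵇ toℕ s) (toℕ-entryF r c)))))
         (trans (count-toℕ n (λ c → inPlex (toℕ r) c ∧ (E (toℕ r) c ≡ᵇ toℕ s)))
                (row-symbol-count (toℕ r) (toℕ s) (toℕ<n r) (toℕ<n s)))) ⟩
      sumFin n (λ r → ind ((toℕ r % M) ≡ᵇ label (toℕ s)))
    ≡⟨ sumFin-toℕ n (λ r → ind ((r % M) ≡ᵇ label (toℕ s))) ⟩
      sumℕ n (λ r → ind ((r % M) ≡ᵇ label (toℕ s)))
    ≡⟨ sym (cnt-sum n (λ r → (r % M) ≡ᵇ label (toℕ s))) ⟩
      cnt n (λ r → (r % M) ≡ᵇ label (toℕ s))
    ≡⟨ residue-count (label (toℕ s)) (label-< (toℕ s)) ⟩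
      k ∎
    where open ≡-Reasoning

  k-plex : HasPlex k square
  k-plex = plexSet , rows-k , columns-k , symbols-k

theorem3p2 : (k m : ℕ) → Odd k → m ≥ 2 →
    Σ (LatinSquare (2 * k * m)) λ L →
    HasPlex k L × (∀ k′ → Odd k′ → k′ < k → ¬ HasPlex k′ L)
theorem3p2 _ m@(suc _) (j , refl) 2≤m = square , k-plex , no-odd-plex
  where open KPlex j m 2≤m
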